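{- Let $\Sigma$ be a finite signature containing two distinct atoms $p_1,p_2$. Then there is no formula $\gamma$ built from atoms of $\Sigma$ using only the connectives $\bot,\vee,\to$ such that $[\![\gamma]\!]=[\![p_1\wedge p_2]\!]$.
   Context: $\Sigma$ is a finite set of atoms. Formulas are given by $\alpha ::= \bot \mid p \mid \alpha_1\wedge\alpha_2 \mid \alpha_1\vee\alpha_2 \mid \alpha_1\rightarrow\alpha_2$ with $p\in\Sigma$. A partial interpretation is a map $v:\Sigma\to\{0,1,2\}$; $\mathcal I$ is the set of all of them and $\mathcal I_c$ the set of classical ones (no atom mapped to $1$). The order on $\mathcal I$: $u\le v$ iff for every atom $p$, $u(p)\le v(p)$ and ($u(p)=0$ implies $v(p)=0$). For $S\subseteq\mathcal I$: $\overline S=\mathcal I\setminus S$; $S_c=S\cap\mathcal I_c$; $S\downarrow=\{u\in\mathcal I:\exists v\in S,\ v\ge u\}$ (so $S_c\downarrow=(S_c)\downarrow$). The denotation: $[\![\bot]\!]=\emptyset$; $[\![p]\!]=\{v\in\mathcal I: v(p)=2\}$; $[\![\alpha\wedge\beta]\!]=[\![\alpha]\!]\cap[\![\beta]\!]$; $[\![\alpha\vee\beta]\!]=[\![\alpha]\!]\cup[\![\beta]\!]$; $[\![\alpha\to\beta]\!]=\big(\overline{[\![\alpha]\!]}\cup[\![\beta]\!]\big)\cap\big(\overline{[\![\alpha]\!]}\cup[\![\beta]\!]\big)_c\downarrow$. -}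

module Defs where

open import Data.Nat using (ℕ)
open import Data.Fin using (Fin)
open import Data.Product using (_×_; Σ-syntax; ∃-syntax)
open import Data.Sum using (_⊎_)
open import Data.Empty using (⊥)
open import Data.Unit using (⊤)
open import Relation.Nullary using (¬_)
open import Relation.Binary.PropositionalEquality using (_≡_; _≢_)

data V3 : Set where
  v0 v1 v2 : V3

data _≤₃_ : V3 → V3 → Set where
  0≤0 : v0 ≤₃ v0
  0≤1 : v0 ≤₃ v1
  0≤2 : v0 ≤₃ v2
  1≤1 : v1 ≤₃ v1
  1≤2 : v1 ≤₃ v2
  2≤2 : v2 ≤₃ v2

-- The signature Σ is Fin n (a finite set of atoms).
Interp : ℕ → Set
Interp n = Fin n → V3

Classical : ∀ {n} → Interp n → Set
Classical v = ∀ p → v p ≢ v1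

_≼_ : ∀ {n} → Interp n → Interp n → Set
u ≼ v = ∀ p → (u p ≤₃ v p) × (u p ≡ v0 → v p ≡ v0)

ISet : ℕ → Set₁
ISet n = Interp n → Set

∁ : ∀ {n} → ISet n → ISet n
∁ S v = ¬ S v

_∪_ : ∀ {n} → ISet n → ISet n → ISet n
(S ∪ T) v = S v ⊎ T v

_∩_ : ∀ {n} → ISet n → ISet n → ISet n
(S ∩ T) v = S v × T v

_ᶜˡ : ∀ {n} → ISet n → ISet n
(S ᶜˡ) v = S v × Classical v

_↓ : ∀ {n} → ISet n → ISet n
(S ↓) u = ∃[ v ] (S v × u ≼ v)

data Form (n : ℕ) : Set where
  ⊥f   : Form n
  atom : Fin n → Form n
  _∧f_ : Form n → Form n → Form n
  _∨f_ : Form n → Form n → Form n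
  _⇒f_ : Form n → Form n → Form n

⟦_⟧ : ∀ {n} → Form n → ISet n
⟦ ⊥f ⟧ v = ⊥
⟦ atom p ⟧ v = v p ≡ v2
⟦ α ∧f β ⟧ = ⟦ α ⟧ ∩ ⟦ β ⟧
⟦ α ∨f β ⟧ = ⟦ α ⟧ ∪ ⟦ β ⟧
⟦ α ⇒f β ⟧ = (∁ ⟦ α ⟧ ∪ ⟦ β ⟧) ∩ (((∁ ⟦ α ⟧ ∪ ⟦ β ⟧) ᶜˡ) ↓)

data BotOrImp {n : ℕ} : Form n → Set where
  ⊥ok   : BotOrImp ⊥f
  atomok : ∀ p → BotOrImp (atom p)
  ∨ok   : ∀ {α β} → BotOrImp α → BotOrImp β → BotOrImp (α ∨f β)
  ⇒ok   : ∀ {α β} → BotOrImp α → BotOrImp β → BotOrImp (α ⇒f β)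

_≐_ : ∀ {n} → ISet n → ISet n → Set
S ≐ T = ∀ v → (S v → T v) × (T v → S v)

-- Read an interpretation u as a here-and-there pair: the atoms valued 2 are the
-- "here" world, those valued 1 or 2 the "there" world, and the unique classical
-- interpretation above u is the there world itself. Truth persists from u to
-- that classical interpretation. Let a, b, c send (p₁ , p₂) to (2 , 1), (1 , 2)
-- and (2 , 2) and every other atom to 0, so a and b lie below the classical c
-- and every atom true at c is true at a or at b. An induction then shows that a
-- formula built from ⊥, ∨ and → that is true at c is true at a or at b, whereas
-- p₁ ∧ p₂ is true at c and at neither.
module Submission where

open import Defs
open import Data.Nat using (ℕ)
open import Data.Fin using (Fin)
open import Data.Fin.Properties using (_≟_)
open import Data.Product using (Σ-syntax; _×_; _,_; proj₁; proj₂)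
open import Data.Sum using (_⊎_; inj₁; inj₂; [_,_]′)
import Data.Sum as Sum
open import Data.Empty using (⊥-elim)
open import Function using (_∘_)
open import Relation.Nullary using (¬_; yes; no)
open import Relation.Binary.PropositionalEquality
  using (_≡_; _≢_; _≗_; refl; sym; trans; subst)

_⊑_ : V3 → V3 → Set
x ⊑ y = x ≤₃ y × (x ≡ v0 → y ≡ v0)

⊑-refl : ∀ {x} → x ⊑ x
⊑-refl {v0} = 0≤0 , λ x≡0 → x≡0
⊑-refl {v1} = 1≤1 , λ x≡0 → x≡0
⊑-refl {v2} = 2≤2 , λ x≡0 → x≡0

v2⊑⇒≡v2 : ∀ {y} → v2 ⊑ y → y ≡ v2
v2⊑⇒≡v2 (2≤2 , _) = refl

complete₃ : V3 → V3
complete₃ v0 = v0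
complete₃ v1 = v2
complete₃ v2 = v2

⊑-classical⇒≡complete₃ : ∀ {x y} → x ⊑ y → y ≢ v1 → y ≡ complete₃ x
⊑-classical⇒≡complete₃ (0≤0 , _)    _     = refl
⊑-classical⇒≡complete₃ (0≤1 , 0⇒0) _     = 0⇒0 refl
⊑-classical⇒≡complete₃ (0≤2 , 0⇒0) _     = 0⇒0 refl
⊑-classical⇒≡complete₃ (1≤1 , _)    y≢v1 = ⊥-elim (y≢v1 refl)
⊑-classical⇒≡complete₃ (1≤2 , _)    _     = refl
⊑-classical⇒≡complete₃ (2≤2 , _)    _     = refl

module _ {n : ℕ} where

  ≼-refl : {u : Interp n} → u ≼ u
  ≼-refl _ = ⊑-refl

  ≼-respˡ-≗ : {u w v : Interp n} → u ≗ w → u ≼ v → w ≼ v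
  ≼-respˡ-≗ {v = v} u≗w u≼v p = subst (_⊑ v p) (u≗w p) (u≼v p)

  ≼-classical-unique : {u w w′ : Interp n} → u ≼ w → Classical w →
                       u ≼ w′ → Classical w′ → w ≗ w′
  ≼-classical-unique u≼w w-cl u≼w′ w′-cl p =
    trans (⊑-classical⇒≡complete₃ (u≼w p) (w-cl p))
          (sym (⊑-classical⇒≡complete₃ (u≼w′ p) (w′-cl p)))

  ⇒-intro-below : (α β : Form n) {u c : Interp n} →
                  (∁ ⟦ α ⟧ ∪ ⟦ β ⟧) u → (∁ ⟦ α ⟧ ∪ ⟦ β ⟧) c →
                  Classical c → u ≼ c → ⟦ α ⇒f β ⟧ u
  ⇒-intro-below α β αβu αβc c-cl u≼c = αβu , _ , (αβc , c-cl) , u≼c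

  ⟦⟧-resp-≗ : (γ : Form n) {u w : Interp n} → u ≗ w → ⟦ γ ⟧ u → ⟦ γ ⟧ w
  ∁∪-resp-≗ : (α β : Form n) {u w : Interp n} → u ≗ w →
              (∁ ⟦ α ⟧ ∪ ⟦ β ⟧) u → (∁ ⟦ α ⟧ ∪ ⟦ β ⟧) w

  ⟦⟧-resp-≗ ⊥f       u≗w ()
  ⟦⟧-resp-≗ (atom q) u≗w uq≡v2 = trans (sym (u≗w q)) uq≡v2
  ⟦⟧-resp-≗ (α ∧f β) u≗w (αu , βu) = ⟦⟧-resp-≗ α u≗w αu , ⟦⟧-resp-≗ β u≗w βu
  ⟦⟧-resp-≗ (α ∨f β) u≗w = Sum.map (⟦⟧-resp-≗ α u≗w) (⟦⟧-resp-≗ β u≗w)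
  ⟦⟧-resp-≗ (α ⇒f β) u≗w (αβu , v , αβv , u≼v) =
    ∁∪-resp-≗ α β u≗w αβu , v , αβv , ≼-respˡ-≗ u≗w u≼v

  ∁∪-resp-≗ α β u≗w (inj₁ ¬αu) = inj₁ (¬αu ∘ ⟦⟧-resp-≗ α (sym ∘ u≗w))
  ∁∪-resp-≗ α β u≗w (inj₂ βu)  = inj₂ (⟦⟧-resp-≗ β u≗w βu)

  ⟦⟧-persistent : (γ : Form n) {u w : Interp n} → u ≼ w → Classical w →
                  ⟦ γ ⟧ u → ⟦ γ ⟧ w
  ⟦⟧-persistent ⊥f       u≼w w-cl ()
  ⟦⟧-persistent (atom q) {w = w} u≼w w-cl uq≡v2 =
    v2⊑⇒≡v2 (subst (_⊑ w q) uq≡v2 (u≼w q))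
  ⟦⟧-persistent (α ∧f β) u≼w w-cl (αu , βu) =
    ⟦⟧-persistent α u≼w w-cl αu , ⟦⟧-persistent β u≼w w-cl βu
  ⟦⟧-persistent (α ∨f β) u≼w w-cl =
    Sum.map (⟦⟧-persistent α u≼w w-cl) (⟦⟧-persistent β u≼w w-cl)
  -- The witness of the downward closure can only be w itself.
  ⟦⟧-persistent (α ⇒f β) u≼w w-cl (_ , w′ , (αβw′ , w′-cl) , u≼w′) =
    ⇒-intro-below α β αβw αβw w-cl ≼-refl
    where
    αβw = ∁∪-resp-≗ α β (≼-classical-unique u≼w′ w′-cl u≼w w-cl) αβw′

  module _ {u₁ u₂ c : Interp n} (u₁≼c : u₁ ≼ c) (u₂≼c : u₂ ≼ c)
           (c-classical : Classical c)
           (atoms-covered : ∀ p → c p ≡ v2 → u₁ p ≡ v2 ⊎ u₂ p ≡ v2) where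

    BotOrImp-split : {γ : Form n} → BotOrImp γ → ⟦ γ ⟧ c → ⟦ γ ⟧ u₁ ⊎ ⟦ γ ⟧ u₂
    BotOrImp-split ⊥ok ()
    BotOrImp-split (atomok q) = atoms-covered q
    BotOrImp-split (∨ok hα _) (inj₁ αc) = Sum.map inj₁ inj₁ (BotOrImp-split hα αc)
    BotOrImp-split (∨ok _ hβ) (inj₂ βc) = Sum.map inj₂ inj₂ (BotOrImp-split hβ βc)
    BotOrImp-split {α ⇒f β} (⇒ok _ hβ) (inj₂ βc , _) =
      Sum.map (λ βu₁ → ⇒-intro-below α β (inj₂ βu₁) (inj₂ βc) c-classical u₁≼c)
              (λ βu₂ → ⇒-intro-below α β (inj₂ βu₂) (inj₂ βc) c-classical u₂≼c)
              (BotOrImp-split hβ βc)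
    BotOrImp-split {α ⇒f β} (⇒ok _ _) (inj₁ ¬αc , _) =
      inj₁ (⇒-intro-below α β (inj₁ ¬αu₁) (inj₁ ¬αc) c-classical u₁≼c)
      where
      ¬αu₁ : ¬ ⟦ α ⟧ u₁
      ¬αu₁ = ¬αc ∘ ⟦⟧-persistent α u₁≼c c-classical

module _ {n : ℕ} (p₁ p₂ : Fin n) where

  pair : V3 → V3 → Interp n
  pair x y p with p ≟ p₁ | p ≟ p₂
  ... | yes _ | _     = x
  ... | no _  | yes _ = y
  ... | no _  | no _  = v0

  pair-at₁ : ∀ {x y} → pair x y p₁ ≡ x
  pair-at₁ with p₁ ≟ p₁
  ... | yes _    = refl
  ... | no p₁≢p₁ = ⊥-elim (p₁≢p₁ refl)

  pair-at₂ : ∀ {x y} → p₁ ≢ p₂ → pair x y p₂ ≡ y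
  pair-at₂ p₁≢p₂ with p₂ ≟ p₁ | p₂ ≟ p₂
  ... | yes p₂≡p₁ | _        = ⊥-elim (p₁≢p₂ (sym p₂≡p₁))
  ... | no _      | yes _    = refl
  ... | no _      | no p₂≢p₂ = ⊥-elim (p₂≢p₂ refl)

  pair-≼ : ∀ {x y x′ y′} → x ⊑ x′ → y ⊑ y′ → pair x y ≼ pair x′ y′
  pair-≼ x⊑x′ y⊑y′ p with p ≟ p₁ | p ≟ p₂
  ... | yes _ | _     = x⊑x′
  ... | no _  | yes _ = y⊑y′
  ... | no _  | no _  = ⊑-refl

  pair-classical : ∀ {x y} → x ≢ v1 → y ≢ v1 → Classical (pair x y)
  pair-classical x≢v1 y≢v1 p with p ≟ p₁ | p ≟ p₂
  ... | yes _ | _     = x≢v1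
  ... | no _  | yes _ = y≢v1
  ... | no _  | no _  = λ ()

  pair-v2-covered : ∀ p → pair v2 v2 p ≡ v2 → pair v2 v1 p ≡ v2 ⊎ pair v1 v2 p ≡ v2
  pair-v2-covered p with p ≟ p₁ | p ≟ p₂
  ... | yes _ | _     = λ _ → inj₁ refl
  ... | no _  | yes _ = λ _ → inj₂ refl
  ... | no _  | no _  = λ ()

theorem5 : (n : ℕ) (p₁ p₂ : Fin n) → p₁ ≢ p₂ →
    ¬ (Σ[ γ ∈ Form n ] (BotOrImp γ × (⟦ γ ⟧ ≐ ⟦ atom p₁ ∧f atom p₂ ⟧)))
theorem5 n p₁ p₂ p₁≢p₂ (γ , γ-⊥∨⇒ , γ≐p₁∧p₂) =
  [ a-fails ∘ to a , b-fails ∘ to b ]′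
    (BotOrImp-split a≼c b≼c c-classical (pair-v2-covered p₁ p₂) γ-⊥∨⇒ γc)
  where
  a b c : Interp n
  a = pair p₁ p₂ v2 v1
  b = pair p₁ p₂ v1 v2
  c = pair p₁ p₂ v2 v2

  a≼c : a ≼ c
  a≼c = pair-≼ p₁ p₂ ⊑-refl (1≤2 , λ ())
  b≼c : b ≼ c
  b≼c = pair-≼ p₁ p₂ (1≤2 , λ ()) ⊑-refl
  c-classical : Classical c
  c-classical = pair-classical p₁ p₂ (λ ()) (λ ())

  to : ∀ v → ⟦ γ ⟧ v → ⟦ atom p₁ ∧f atom p₂ ⟧ v
  to v = proj₁ (γ≐p₁∧p₂ v)
  γc : ⟦ γ ⟧ c
  γc = proj₂ (γ≐p₁∧p₂ c) (pair-at₁ p₁ p₂ , pair-at₂ p₁ p₂ p₁≢p₂)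

  a-fails : ¬ ⟦ atom p₁ ∧f atom p₂ ⟧ a
  a-fails (_ , a-p₂≡v2) with trans (sym (pair-at₂ p₁ p₂ p₁≢p₂)) a-p₂≡v2
  ... | ()
  b-fails : ¬ ⟦ atom p₁ ∧f atom p₂ ⟧ b
  b-fails (b-p₁≡v2 , _) with trans (sym (pair-at₁ p₁ p₂)) b-p₁≡v2
  ... | ()
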